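{- Define integers $\alpha(i,j)$ for $i\geq 1$, $0\leq j\leq i$ by $\alpha(i,0)=0$, $\alpha(i,i)=1$, and $\alpha(i,j)=\sum_{k=j-1}^{i-1}\alpha(i-1,k)$ for $1\leq j<i$, and let $t(p)=\sum_{j=1}^{p}2^j\alpha(p,j)$. Then $t(p)\leq 2^{2p}-\binom{2p}{p}$ for every $p\geq 1$. -}

module Defs where

open import Data.Nat using (ℕ; zero; suc; _+_; _*_; _∸_; _^_; _≤_; _<_; _≡ᵇ_; _<ᵇ_)
open import Data.Bool using (if_then_else_)
open import Data.List using (List; map)
open import Data.Nat.ListAction using (sum)
open import Data.List.Base using (upTo)

-- Σ_{k = a}^{b} f k  (empty sum = 0 when b < a)
rangeSum : (ℕ → ℕ) → ℕ → ℕ → ℕ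
rangeSum f a b = sum (map (λ d → f (a + d)) (upTo (suc b ∸ a)))

-- α i j as in the paper, for i ≥ 1 and 0 ≤ j ≤ i.
-- Values outside that range (i = 0, or j > i) are set to 0 and are never used.
-- α(i,0) = 0, α(i,i) = 1, α(i,j) = Σ_{k=j-1}^{i-1} α(i-1,k) for 1 ≤ j < i.
α : ℕ → ℕ → ℕ
α zero j = 0
α (suc i) zero = 0
α (suc i) (suc j) =
  if j ≡ᵇ i then 1
  else (if j <ᵇ i then rangeSum (α i) j i else 0)

t : ℕ → ℕ
t p = rangeSum (λ j → 2 ^ j * α p j) 1 p

-- Write S_i = Σ_{k=0}^{i} α(i,k) and t(i) = Σ_{k=0}^{i} 2^k α(i,k) (the k = 0
-- term vanishes).  For i ≥ 1 the recurrence expresses α(i+1,j+1) as the tail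
-- sum Σ_{k=j}^{i} α(i,k); interchanging the two summations and summing the
-- geometric weights Σ_{j≤k} 2^{j+1} = 4·2^k − 2 gives the exact recurrence
--
--     t(i+1) + 2·S_i = 4·t(i),     hence   t(i+1) ≤ 4·t(i).
--
-- With t(1) = 2 this yields t(p) ≤ 2^{2p-1}.  On the other side, Pascal's rule
-- shows that two adjacent binomial coefficients of order n add up to at most
-- 2^n, so C(2p,p) = C(2p-1,p-1) + C(2p-1,p) ≤ 2^{2p-1}.  Adding the two bounds
-- gives t(p) + C(2p,p) ≤ 2^{2p}, which is the theorem.

module Submission where

open import Defs
open import Data.Nat using (ℕ; zero; suc; _+_; _*_; _∸_; _^_; _≤_; _<_; z≤n; s≤s; z<s; s<s; _≡ᵇ_; _<ᵇ_)
open import Data.Nat.Properties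
open import Data.Nat.Combinatorics using (_C_; nCk+nC[k+1]≡[n+1]C[k+1])
open import Data.Nat.ListAction using (sum)
open import Data.Nat.Tactic.RingSolver using (solve-∀)
open import Data.List using (map; applyUpTo)
open import Data.Bool using (true; false; T)
open import Data.Bool.Properties using (T-≡)
open import Data.Unit using (tt)
open import Data.Empty using (⊥-elim)
open import Function.Bundles using (Equivalence)
open import Relation.Binary.PropositionalEquality

-- sumBelow f n = f 0 + f 1 + … + f (n − 1), recursing on the first term so
-- that it unfolds in step with `applyUpTo`.
sumBelow : (ℕ → ℕ) → ℕ → ℕ
sumBelow f zero    = 0
sumBelow f (suc n) = f 0 + sumBelow (λ d → f (suc d)) n

sumBelow-cong : ∀ {f g : ℕ → ℕ} n → (∀ x → x < n → f x ≡ g x) → sumBelow f n ≡ sumBelow g n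
sumBelow-cong zero    f≡g = refl
sumBelow-cong (suc n) f≡g =
  cong₂ _+_ (f≡g 0 z<s) (sumBelow-cong n (λ x x<n → f≡g (suc x) (s<s x<n)))

sumBelow-double-weight : ∀ (w f : ℕ → ℕ) n →
  sumBelow (λ k → 2 * w k * f k) n ≡ 2 * sumBelow (λ k → w k * f k) n
sumBelow-double-weight w f zero    = refl
sumBelow-double-weight w f (suc n) = begin
    2 * w 0 * f 0 + sumBelow (λ k → 2 * w (suc k) * f (suc k)) n
  ≡⟨ cong₂ _+_ (*-assoc 2 (w 0) (f 0)) (sumBelow-double-weight (λ k → w (suc k)) (λ k → f (suc k)) n) ⟩
    2 * (w 0 * f 0) + 2 * sumBelow (λ k → w (suc k) * f (suc k)) n
  ≡⟨ *-distribˡ-+ 2 (w 0 * f 0) _ ⟨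
    2 * sumBelow (λ k → w k * f k) (suc n) ∎
  where open ≡-Reasoning

sum-applyUpTo : ∀ (f h : ℕ → ℕ) n → sum (map f (applyUpTo h n)) ≡ sumBelow (λ d → f (h d)) n
sum-applyUpTo f h zero    = refl
sum-applyUpTo f h (suc n) = cong (f (h 0) +_) (sum-applyUpTo f (λ d → h (suc d)) n)

rangeSum≡sumBelow : ∀ f a b → rangeSum f a b ≡ sumBelow (λ d → f (a + d)) (suc b ∸ a)
rangeSum≡sumBelow f a b = sum-applyUpTo (λ d → f (a + d)) (λ d → d) (suc b ∸ a)

rangeSum-single : ∀ f n → rangeSum f n n ≡ f n
rangeSum-single f n rewrite m+n∸n≡m 1 n = trans (+-identityʳ _) (cong f (+-identityʳ n))

weightedSum : (ℕ → ℕ) → ℕ → ℕ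
weightedSum a n = sumBelow (λ k → 2 ^ k * a k) n

tailSum : (ℕ → ℕ) → ℕ → ℕ → ℕ
tailSum a j n = sumBelow (λ d → a (j + d)) (n ∸ j)

-- Interchange of summation: Σ_{j<n} 2^{j+1} Σ_{j≤k<n} a(k) = Σ_{k<n} (2^{k+2} − 2) a(k),
-- stated without subtraction.  Induction on n peels off the term j = 0.
tails-interchange : ∀ a n →
  sumBelow (λ j → 2 ^ suc j * tailSum a j n) n + 2 * sumBelow a n ≡ 4 * weightedSum a n
tails-interchange a zero    = refl
tails-interchange a (suc n) = begin
    2 * s + tails + 2 * s
  ≡⟨ cong (λ z → 2 * s + z + 2 * s)
       (sumBelow-double-weight (λ j → 2 ^ suc j) (λ j → tailSum a' j n) n) ⟩
    2 * s + 2 * tails' + 2 * s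
  ≡⟨ regroup (a 0) (sumBelow a' n) tails' ⟩
    4 * a 0 + 2 * (tails' + 2 * sumBelow a' n)
  ≡⟨ cong (λ z → 4 * a 0 + 2 * z) (tails-interchange a' n) ⟩
    4 * a 0 + 2 * (4 * weightedSum a' n)
  ≡⟨ factor (a 0) (weightedSum a' n) ⟩
    4 * (a 0 + 2 * weightedSum a' n)
  ≡⟨ cong (4 *_) (cong₂ _+_ (sym (*-identityˡ (a 0)))
       (sym (sumBelow-double-weight (2 ^_) a' n))) ⟩
    4 * weightedSum a (suc n) ∎
  where
  open ≡-Reasoning
  a' : ℕ → ℕ
  a' d = a (suc d)
  s tails tails' : ℕ
  s      = sumBelow a (suc n)
  tails  = sumBelow (λ j → 2 ^ suc (suc j) * tailSum a' j n) n
  tails' = sumBelow (λ j → 2 ^ suc j * tailSum a' j n) n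
  regroup : ∀ x y l → 2 * (x + y) + 2 * l + 2 * (x + y) ≡ 4 * x + 2 * (l + 2 * y)
  regroup = solve-∀
  factor : ∀ x r → 4 * x + 2 * (4 * r) ≡ 4 * (x + 2 * r)
  factor = solve-∀

α-diag : ∀ i → 1 ≤ i → α i i ≡ 1
α-diag (suc m) _ rewrite Equivalence.to T-≡ (≡⇒≡ᵇ m m refl) = refl

α-rec : ∀ i j → 1 ≤ i → j ≤ i → α (suc i) (suc j) ≡ rangeSum (α i) j i
α-rec i j 1≤i j≤i with j ≡ᵇ i in j≟i
... | true with ≡ᵇ⇒≡ j i (subst T (sym j≟i) tt)
...   | refl = sym (trans (rangeSum-single (α i) i) (α-diag i 1≤i))
α-rec i j 1≤i j≤i | false with j <ᵇ i in j<?i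
... | true  = refl
... | false = ⊥-elim (subst T j<?i (<⇒<ᵇ j<i))
  where
  j<i : j < i
  j<i = ≤∧≢⇒< j≤i (λ j≡i → subst T j≟i (≡⇒≡ᵇ j i j≡i))

-- t(i) is the full weighted sum of row i, since α(i,0) = 0.
t≡weightedSum : ∀ i → t i ≡ weightedSum (α i) (suc i)
t≡weightedSum zero    = refl
t≡weightedSum (suc m) = rangeSum≡sumBelow (λ j → 2 ^ j * α (suc m) j) 1 (suc m)

t-suc≡tails : ∀ i → 1 ≤ i → t (suc i) ≡ sumBelow (λ j → 2 ^ suc j * tailSum (α i) j (suc i)) (suc i)
t-suc≡tails i 1≤i = trans (rangeSum≡sumBelow (λ j → 2 ^ j * α (suc i) j) 1 (suc i))
  (sumBelow-cong (suc i) λ j j≤i → cong (2 ^ suc j *_)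
    (trans (α-rec i j 1≤i (≤-pred j≤i)) (rangeSum≡sumBelow (α i) j i)))

t-recurrence : ∀ i → 1 ≤ i → t (suc i) + 2 * sumBelow (α i) (suc i) ≡ 4 * t i
t-recurrence i 1≤i = begin
    t (suc i) + 2 * sumBelow (α i) (suc i)
  ≡⟨ cong (_+ 2 * sumBelow (α i) (suc i)) (t-suc≡tails i 1≤i) ⟩
    sumBelow (λ j → 2 ^ suc j * tailSum (α i) j (suc i)) (suc i) + 2 * sumBelow (α i) (suc i)
  ≡⟨ tails-interchange (α i) (suc i) ⟩
    4 * weightedSum (α i) (suc i)
  ≡⟨ cong (4 *_) (t≡weightedSum i) ⟨
    4 * t i ∎
  where open ≡-Reasoning

2^n+2^n≡2^[1+n] : ∀ n → 2 ^ n + 2 ^ n ≡ 2 ^ suc n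
2^n+2^n≡2^[1+n] n = cong (2 ^ n +_) (sym (+-identityʳ (2 ^ n)))

t-bound : ∀ m → t (suc m) ≤ 2 ^ suc (m + m)
t-bound zero    = ≤-refl
t-bound (suc m) = begin
    t (suc (suc m))
  ≤⟨ m≤m+n _ _ ⟩
    t (suc (suc m)) + 2 * sumBelow (α (suc m)) (suc (suc m))
  ≡⟨ t-recurrence (suc m) (s≤s z≤n) ⟩
    4 * t (suc m)
  ≤⟨ *-monoʳ-≤ 4 (t-bound m) ⟩
    4 * 2 ^ suc (m + m)
  ≡⟨ *-assoc 2 2 (2 ^ suc (m + m)) ⟩
    2 ^ suc (suc (suc (m + m)))
  ≡⟨ cong (λ e → 2 ^ suc (suc e)) (+-suc m m) ⟨
    2 ^ suc (suc m + suc m) ∎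
  where open ≤-Reasoning

adjacent-binomials-bound : ∀ n k → n C k + n C suc k ≤ 2 ^ n
adjacent-binomials-bound zero    zero    = ≤-refl
adjacent-binomials-bound zero    (suc k) = z≤n
adjacent-binomials-bound (suc n) zero    = begin
    1 + suc n C 1
  ≡⟨ cong suc (nCk+nC[k+1]≡[n+1]C[k+1] n 0) ⟨
    1 + (n C 0 + n C 1)
  ≤⟨ +-mono-≤ (m^n>0 2 n) (adjacent-binomials-bound n 0) ⟩
    2 ^ n + 2 ^ n
  ≡⟨ 2^n+2^n≡2^[1+n] n ⟩
    2 ^ suc n ∎
  where open ≤-Reasoning
adjacent-binomials-bound (suc n) (suc k) = begin
    suc n C suc k + suc n C suc (suc k)
  ≡⟨ cong₂ _+_ (nCk+nC[k+1]≡[n+1]C[k+1] n k) (nCk+nC[k+1]≡[n+1]C[k+1] n (suc k)) ⟨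
    (n C k + n C suc k) + (n C suc k + n C suc (suc k))
  ≤⟨ +-mono-≤ (adjacent-binomials-bound n k) (adjacent-binomials-bound n (suc k)) ⟩
    2 ^ n + 2 ^ n
  ≡⟨ 2^n+2^n≡2^[1+n] n ⟩
    2 ^ suc n ∎
  where open ≤-Reasoning

2*[1+m]≡2+[m+m] : ∀ m → 2 * suc m ≡ suc (suc (m + m))
2*[1+m]≡2+[m+m] = solve-∀

central-binomial-bound : ∀ m → (2 * suc m) C suc m ≤ 2 ^ suc (m + m)
central-binomial-bound m = begin
    (2 * suc m) C suc m
  ≡⟨ cong (_C suc m) (2*[1+m]≡2+[m+m] m) ⟩
    suc (suc (m + m)) C suc m
  ≡⟨ nCk+nC[k+1]≡[n+1]C[k+1] (suc (m + m)) m ⟨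
    suc (m + m) C m + suc (m + m) C suc m
  ≤⟨ adjacent-binomials-bound (suc (m + m)) m ⟩
    2 ^ suc (m + m) ∎
  where open ≤-Reasoning

lemma10 : (p : ℕ) → 1 ≤ p → t p ≤ 2 ^ (2 * p) ∸ (2 * p) C p
lemma10 (suc m) _ = m+n≤o⇒m≤o∸n (t (suc m)) (begin
    t (suc m) + (2 * suc m) C suc m
  ≤⟨ +-mono-≤ (t-bound m) (central-binomial-bound m) ⟩
    2 ^ suc (m + m) + 2 ^ suc (m + m)
  ≡⟨ 2^n+2^n≡2^[1+n] (suc (m + m)) ⟩
    2 ^ suc (suc (m + m))
  ≡⟨ cong (2 ^_) (2*[1+m]≡2+[m+m] m) ⟨
    2 ^ (2 * suc m) ∎)
  where open ≤-Reasoning
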